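{- If $L$ is a regular language in $\mathbf J\ast\mathbf G$, then $\mathrm{Member}(L)$ is in $\mathrm{UDyn}\Sigma_1$.
   Context: Dynamic descriptive complexity: a word $w_1\cdots w_n$, $w_i\in\Sigma\cup\{\epsilon\}$, encoded on domain $\{1,\dots,n\}$ with disjoint unary relations $W_\sigma$ and the order $\le$; changes $\mathrm{set}_\sigma(i)$ set position $i$ to $\sigma$; a dynamic program has update formulas $\varphi^R_\sigma(\bar x;y)$, the new $R$ being the tuples $\bar a$ with $\varphi^R_\sigma(\bar a;i)$ true in (changed word, old auxiliary relations); the initial word is $\epsilon^n$ with first-order initialization. $\mathrm{Member}(L)$ is maintained if a distinguished $0$-ary relation is true iff the current word (non-$\epsilon$ symbols) is in $L$. $\mathrm{UDyn}\Sigma_1$: auxiliary relations of arity $\le1$ and update formulas in prenex form using only existential quantifiers (negation allowed anywhere in the quantifier-free part). $\mathbf J\ast\mathbf G$ denotes the class of regular languages that are Boolean combinations of group monomials, i.e. of languages $L_1a_1L_2\cdots a_nL_{n+1}$ with $a_1,\dots,a_n\in\Sigma$ and each $L_i\subseteq\Sigma^*$ recognized by a finite group (equivalently, languages recognized by a monoid dividing a semidirect product of a $\mathcal J$-trivial finite monoid by a finite group). -}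

module Defs where

open import Data.Nat using (ℕ; zero; suc; _≤ᵇ_)
open import Data.Fin using (Fin; zero; suc; toℕ; _≟_)
open import Data.Bool using (Bool; true; false; not; _∧_; _∨_; if_then_else_)
open import Data.Maybe using (Maybe; just; nothing)
open import Data.List using (List; []; _∷_; _++_; foldr; foldl)
open import Data.Product using (Σ; ∃; ∃-syntax; _×_; _,_)
open import Data.Sum using (_⊎_)
open import Relation.Nullary using (¬_)
open import Relation.Nullary.Decidable using (⌊_⌋)
open import Relation.Binary.PropositionalEquality using (_≡_)
open import Algebra.Structures using (IsGroup)
open import Function.Bundles using (_⇔_)

Language : ℕ → Set₁
Language k = List (Fin k) → Set

record FinGroup : Set where
  field
    m       : ℕ
    _∙_     : Fin m → Fin m → Fin m
    e       : Fin m
    _⁻¹     : Fin m → Fin m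
    isGroup : IsGroup _≡_ _∙_ e _⁻¹

-- A language recognized by a finite group G: the monoid morphism
-- Σ* → G is determined by its values h on letters, and F is the
-- accepting subset of G.
record GroupLang (k : ℕ) : Set where
  field
    G : FinGroup
  open FinGroup G
  field
    h : Fin k → Fin m
    F : Fin m → Bool
  hom : List (Fin k) → Fin m
  hom = foldr (λ a g → h a ∙ g) e

  lang : Language k
  lang w = F (hom w) ≡ true

-- Group monomial  L₁ a₁ L₂ ⋯ aₙ Lₙ₊₁  (n ≥ 0), each Lᵢ a group language.
record Monomial (k : ℕ) : Set where
  constructor mono
  field
    first : GroupLang k
    rest  : List (Fin k × GroupLang k)

monoLang : ∀ {k} → GroupLang k → List (Fin k × GroupLang k) → Language k
monoLang L₁ [] w = GroupLang.lang L₁ w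
monoLang L₁ ((a , L₂) ∷ r) w =
  ∃[ u ] ∃[ v ] (w ≡ u ++ (a ∷ v)) × GroupLang.lang L₁ u × monoLang L₂ r v

⟦_⟧M : ∀ {k} → Monomial k → Language k
⟦ mono L₁ r ⟧M = monoLang L₁ r

data BoolComb (k : ℕ) : Set where
  atom : Monomial k → BoolComb k
  neg  : BoolComb k → BoolComb k
  conj : BoolComb k → BoolComb k → BoolComb k
  disj : BoolComb k → BoolComb k → BoolComb k

⟦_⟧B : ∀ {k} → BoolComb k → Language k
⟦ atom M ⟧B w = ⟦ M ⟧M w
⟦ neg B ⟧B w = ¬ ⟦ B ⟧B w
⟦ conj B C ⟧B w = ⟦ B ⟧B w × ⟦ C ⟧B w
⟦ disj B C ⟧B w = ⟦ B ⟧B w ⊎ ⟦ C ⟧B w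

InJG : ∀ {k} → Language k → Set
InJG {k} L = Σ (BoolComb k) λ B → ∀ w → L w ⇔ ⟦ B ⟧B w

-- First-order logic over word structures with auxiliary relations
-- Vocabulary: W_σ (σ : Fin k), ≤, =, a0 nullary and a1 unary
-- auxiliary relations. Variables are de Bruijn indices Fin v.

data Atom (k a0 a1 v : ℕ) : Set where
  letter : Fin k → Fin v → Atom k a0 a1 v
  leq    : Fin v → Fin v → Atom k a0 a1 v
  eq     : Fin v → Fin v → Atom k a0 a1 v
  rel0   : Fin a0 → Atom k a0 a1 v
  rel1   : Fin a1 → Fin v → Atom k a0 a1 v

data QF (k a0 a1 v : ℕ) : Set where
  atom : Atom k a0 a1 v → QF k a0 a1 v
  tt   : QF k a0 a1 v
  neg  : QF k a0 a1 v → QF k a0 a1 v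
  conj : QF k a0 a1 v → QF k a0 a1 v → QF k a0 a1 v
  disj : QF k a0 a1 v → QF k a0 a1 v → QF k a0 a1 v

data ExFO (k a0 a1 v : ℕ) : Set where
  qf : QF k a0 a1 v → ExFO k a0 a1 v
  ex : ExFO k a0 a1 (suc v) → ExFO k a0 a1 v

data FO (k a0 a1 v : ℕ) : Set where
  atom : Atom k a0 a1 v → FO k a0 a1 v
  neg  : FO k a0 a1 v → FO k a0 a1 v
  conj : FO k a0 a1 v → FO k a0 a1 v → FO k a0 a1 v
  ex   : FO k a0 a1 (suc v) → FO k a0 a1 v
  all  : FO k a0 a1 (suc v) → FO k a0 a1 v

-- word over Σ ∪ {ε} of length n (nothing = ε)
Word : ℕ → ℕ → Set
Word k n = Fin n → Maybe (Fin k)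

-- structures on domain Fin n (positions 1..n as 0..n-1)
record Str (k a0 a1 n : ℕ) : Set where
  field
    word : Word k n
    r0   : Fin a0 → Bool
    r1   : Fin a1 → Fin n → Bool
open Str public

anyFin : ∀ {n} → (Fin n → Bool) → Bool
anyFin {zero}  f = false
anyFin {suc n} f = f zero ∨ anyFin (λ i → f (suc i))

allFin : ∀ {n} → (Fin n → Bool) → Bool
allFin {zero}  f = true
allFin {suc n} f = f zero ∧ allFin (λ i → f (suc i))

ext : ∀ {n v} → Fin n → (Fin v → Fin n) → Fin (suc v) → Fin n
ext d ρ zero    = d
ext d ρ (suc i) = ρ i

isLetter : ∀ {k} → Maybe (Fin k) → Fin k → Bool
isLetter nothing  σ = false
isLetter (just τ) σ = ⌊ τ ≟ σ ⌋

evalAtom : ∀ {k a0 a1 n v} → Str k a0 a1 n → (Fin v → Fin n) → Atom k a0 a1 v → Bool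
evalAtom S ρ (letter σ t) = isLetter (word S (ρ t)) σ
evalAtom S ρ (leq t u)    = toℕ (ρ t) ≤ᵇ toℕ (ρ u)
evalAtom S ρ (eq t u)     = ⌊ ρ t ≟ ρ u ⌋
evalAtom S ρ (rel0 j)     = r0 S j
evalAtom S ρ (rel1 j t)   = r1 S j (ρ t)

evalQF : ∀ {k a0 a1 n v} → Str k a0 a1 n → (Fin v → Fin n) → QF k a0 a1 v → Bool
evalQF S ρ (atom a)   = evalAtom S ρ a
evalQF S ρ tt         = true
evalQF S ρ (neg φ)    = not (evalQF S ρ φ)
evalQF S ρ (conj φ ψ) = evalQF S ρ φ ∧ evalQF S ρ ψ
evalQF S ρ (disj φ ψ) = evalQF S ρ φ ∨ evalQF S ρ ψ

evalEx : ∀ {k a0 a1 n v} → Str k a0 a1 n → (Fin v → Fin n) → ExFO k a0 a1 v → Bool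
evalEx S ρ (qf φ) = evalQF S ρ φ
evalEx S ρ (ex φ) = anyFin (λ d → evalEx S (ext d ρ) φ)

evalFO : ∀ {k a0 a1 n v} → Str k a0 a1 n → (Fin v → Fin n) → FO k a0 a1 v → Bool
evalFO S ρ (atom a)   = evalAtom S ρ a
evalFO S ρ (neg φ)    = not (evalFO S ρ φ)
evalFO S ρ (conj φ ψ) = evalFO S ρ φ ∧ evalFO S ρ ψ
evalFO S ρ (ex φ)     = anyFin (λ d → evalFO S (ext d ρ) φ)
evalFO S ρ (all φ)    = allFin (λ d → evalFO S (ext d ρ) φ)

-- Variable conventions (de Bruijn, index zero first):
--   upd0 σ j : context (y)       — y = zero
--   upd1 σ j : context (x ; y)   — x = zero, y = suc zero
--   init1 j  : context (x)       — x = zero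
-- Changes set_σ(i) with σ ∈ Σ ∪ {ε} encoded as σ : Maybe (Fin k).
record UDynProg (k a0 a1 : ℕ) : Set where
  field
    acc   : Fin a0
    init0 : Fin a0 → FO k 0 0 0
    init1 : Fin a1 → FO k 0 0 1
    upd0  : Maybe (Fin k) → Fin a0 → ExFO k a0 a1 1
    upd1  : Maybe (Fin k) → Fin a1 → ExFO k a0 a1 2

Change : ℕ → ℕ → Set
Change k n = Maybe (Fin k) × Fin n

setWord : ∀ {k n} → Change k n → Word k n → Word k n
setWord (σ , i) w j = if ⌊ j ≟ i ⌋ then σ else w j

env1 : ∀ {n} → Fin n → Fin 1 → Fin n
env1 y zero = y

env2 : ∀ {n} → Fin n → Fin n → Fin 2 → Fin n
env2 x y zero       = x
env2 x y (suc zero) = y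

module _ {k a0 a1 : ℕ} (P : UDynProg k a0 a1) where
  open UDynProg P

  initStr : (n : ℕ) → Str k a0 a1 n
  initStr n = record
    { word = λ _ → nothing
    ; r0   = λ j → evalFO S₀ (λ ()) (init0 j)
    ; r1   = λ j x → evalFO S₀ (env1 x) (init1 j)
    }
    where
      S₀ : Str k 0 0 n
      S₀ = record { word = λ _ → nothing ; r0 = λ () ; r1 = λ () }

  step : ∀ {n} → Str k a0 a1 n → Change k n → Str k a0 a1 n
  step S (σ , i) = record
    { word = word S'
    ; r0   = λ j → evalEx S' (env1 i) (upd0 σ j)
    ; r1   = λ j x → evalEx S' (env2 x i) (upd1 σ j)
    }
    where
      S' : Str k a0 a1 _
      S' = record { word = setWord (σ , i) (word S) ; r0 = r0 S ; r1 = r1 S }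

  run : (n : ℕ) → List (Change k n) → Str k a0 a1 n
  run n cs = foldl step (initStr n) cs

wordList : ∀ {k n} → Word k n → List (Fin k)
wordList {n = zero}  w = []
wordList {n = suc n} w with w zero
... | nothing = wordList (λ i → w (suc i))
... | just a  = a ∷ wordList (λ i → w (suc i))

Maintains : ∀ {k a0 a1} → UDynProg k a0 a1 → Language k → Set
Maintains P L = ∀ n (cs : List (Change _ n)) →
  (r0 (run P n cs) (UDynProg.acc P) ≡ true) ⇔ L (wordList (word (run P n cs)))

MemberInUDynΣ₁ : ∀ {k} → Language k → Set
MemberInUDynΣ₁ {k} L = Σ ℕ λ a0 → Σ ℕ λ a1 → Σ (UDynProg k a0 a1) λ P → Maintains P L

-- Store at every position y of the current word w the value, in each of the finite groups, of
-- the prefix of w before y, and for every monomial of the Boolean combination and every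
-- c ∈ Σ ∪ {ε} whether the monomial accepts w with y set to c; this is unary information.
-- After w[i] changes from α to β, the prefix value p of a position after i becomes
-- (pᵢ·β)(pᵢ·α)⁻¹p, computed from the data at i and at that position, and w is accepted iff
-- the table at i says so for β.  The table at x is recomputed by existentially guessing the
-- positions t₁ < ⋯ < tₙ of the monomial's letters: the group value of the factor strictly
-- between tⱼ and tⱼ₊₁ is (p_{tⱼ}·w[tⱼ])⁻¹ p_{tⱼ₊₁}, where the prefix values are those of the
-- word changed at i and then at x, obtained by applying the update rule twice.  The one
-- universal property needed, being the last position, never changes and is fixed at
-- initialisation.

module Submission where

open import Data.Nat using (ℕ; zero; suc; _≤ᵇ_; _<_; _≤_; _+_)
open import Data.Nat.Properties using (<-trans; <-irrefl; ≤-refl; <-≤-trans; ≰⇒>; ≤ᵇ⇒≤; ≤⇒≤ᵇ)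
open import Data.Fin using (Fin; zero; suc; toℕ; _≟_; fromℕ; _↑ˡ_; _↑ʳ_)
open import Data.Fin.Properties using (toℕ-fromℕ; toℕ≤pred[n])
open import Data.Bool using (Bool; true; false; not; _∧_; _∨_; if_then_else_)
open import Data.Bool.Properties using (∨-identityʳ; ∧-identityʳ; ∧-zeroʳ; ∧-comm; T-≡)
open import Data.Maybe using (Maybe; just; nothing; maybe) renaming (map to mapMaybe)
open import Data.List using (List; []; _∷_; _++_; foldl; fromMaybe)
open import Data.Vec using (Vec; []; _∷_; lookup; tabulate; map) renaming (_++_ to _++ᵛ_)
open import Data.Vec.Properties
  using (lookup-++ˡ; lookup-++ʳ; lookup∘tabulate; tabulate∘lookup; tabulate-cong; tabulate-∘; map-++; lookup-map)
open import Data.Vec.Functional using (tail)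
open import Data.List.Properties using (++-assoc; ++-identityʳ; ∷-injective)
open import Data.Product using (Σ; ∃-syntax; _×_; _,_; proj₁; proj₂)
open import Data.Sum using (inj₁; inj₂)
open import Data.Empty using (⊥-elim)
open import Relation.Nullary using (yes; no; contradiction)
open import Relation.Nullary.Decidable using (⌊_⌋)
open import Relation.Binary.PropositionalEquality
open import Algebra.Structures using (IsGroup)
open import Function.Bundles using (_⇔_; mk⇔; Equivalence)
open import Function.Base using (_∘_; case_of_)
open import Defs

open Equivalence using (to; from)

∧-elim : ∀ {a b} → (a ∧ b) ≡ true → a ≡ true × b ≡ true
∧-elim {true} {true} _ = refl , refl

∧-intro : ∀ {a b} → a ≡ true → b ≡ true → (a ∧ b) ≡ true
∧-intro refl refl = refl

∧-congˡ-if : ∀ a {x y} → (a ≡ true → x ≡ y) → (a ∧ x) ≡ (a ∧ y)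
∧-congˡ-if true  x≡y = x≡y refl
∧-congˡ-if false _   = refl

Bool-≡-via-⇔ : ∀ {X : Set} {a b : Bool} → (a ≡ true ⇔ X) → (b ≡ true ⇔ X) → a ≡ b
Bool-≡-via-⇔ {a = true}  {true}  _ _ = refl
Bool-≡-via-⇔ {a = true}  {false} a⇔ b⇔ = sym (from b⇔ (to a⇔ refl))
Bool-≡-via-⇔ {a = false} {true}  a⇔ b⇔ = from a⇔ (to b⇔ refl)
Bool-≡-via-⇔ {a = false} {false} _ _ = refl

≟-refl : ∀ {n} (x : Fin n) → ⌊ x ≟ x ⌋ ≡ true
≟-refl x with x ≟ x
... | yes _   = refl
... | no  x≢x = contradiction refl x≢x

≟-sound : ∀ {n} (y x : Fin n) → ⌊ y ≟ x ⌋ ≡ true → y ≡ x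
≟-sound y x y≟x with y ≟ x
... | yes y≡x = y≡x

≟-suc : ∀ {n} (y z : Fin n) → ⌊ suc y ≟ suc z ⌋ ≡ ⌊ y ≟ z ⌋
≟-suc y z with y ≟ z
... | yes _ = refl
... | no  _ = refl

anyFin-cong : ∀ {n} {f g : Fin n → Bool} → (∀ d → f d ≡ g d) → anyFin f ≡ anyFin g
anyFin-cong {zero}  f≗g = refl
anyFin-cong {suc n} f≗g = cong₂ _∨_ (f≗g zero) (anyFin-cong (λ d → f≗g (suc d)))

anyFin-∧ˡ : ∀ {n} b (f : Fin n → Bool) → anyFin (λ d → b ∧ f d) ≡ (b ∧ anyFin f)
anyFin-∧ˡ {zero}  true  f = refl
anyFin-∧ˡ {zero}  false f = refl
anyFin-∧ˡ {suc n} true  f = cong (f zero ∨_) (anyFin-∧ˡ true (λ d → f (suc d)))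
anyFin-∧ˡ {suc n} false f = anyFin-∧ˡ false (λ d → f (suc d))

anyFin-intro : ∀ {n} (f : Fin n → Bool) d → f d ≡ true → anyFin f ≡ true
anyFin-intro f zero    fd rewrite fd = refl
anyFin-intro f (suc d) fd with f zero
... | true  = refl
... | false = anyFin-intro (λ d → f (suc d)) d fd

anyFin-elim : ∀ {n} (f : Fin n → Bool) → anyFin f ≡ true → ∃[ d ] f d ≡ true
anyFin-elim {suc n} f any with f zero in f0
... | true  = zero , f0
... | false = let d , fd = anyFin-elim (λ d → f (suc d)) any in suc d , fd

anyFin-false : ∀ {n} (f : Fin n → Bool) → (∀ d → f d ≡ false) → anyFin f ≡ false
anyFin-false {zero}  f none = refl
anyFin-false {suc n} f none rewrite none zero = anyFin-false (λ d → f (suc d)) (λ d → none (suc d))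

anyFin-guarded : ∀ {n} (P g : Fin n → Bool) (G : Bool) (d₀ : Fin n) → P d₀ ≡ true →
  (∀ d → P d ≡ true → g d ≡ G) → anyFin (λ d → P d ∧ g d) ≡ G
anyFin-guarded P g true  d₀ Pd₀ g≡G = anyFin-intro _ d₀ (trans (cong (_∧ g d₀) Pd₀) (g≡G d₀ Pd₀))
anyFin-guarded P g false d₀ Pd₀ g≡G = anyFin-false _ (λ d → guardedFalse d (P d) refl)
  where
  guardedFalse : ∀ d b → P d ≡ b → (P d ∧ g d) ≡ false
  guardedFalse d true  Pd rewrite Pd = g≡G d Pd
  guardedFalse d false Pd rewrite Pd = refl

allFin-intro : ∀ {n} (f : Fin n → Bool) → (∀ d → f d ≡ true) → allFin f ≡ true
allFin-intro {zero}  f f≡true = refl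
allFin-intro {suc n} f f≡true rewrite f≡true zero = allFin-intro (λ d → f (suc d)) (λ d → f≡true (suc d))

allFin-elim : ∀ {n} (f : Fin n → Bool) → allFin f ≡ true → ∀ d → f d ≡ true
allFin-elim {suc n} f allf d with f zero in f0
allFin-elim {suc n} f allf zero    | true = f0
allFin-elim {suc n} f allf (suc d) | true = allFin-elim (λ d → f (suc d)) allf d

-- stated as the atom leq expresses it, so that formulas can read it off
_<ᵇ_ : ∀ {n} → Fin n → Fin n → Bool
y <ᵇ x = not (toℕ x ≤ᵇ toℕ y)

<ᵇ-true : ∀ {n} {y x : Fin n} → toℕ y < toℕ x → (y <ᵇ x) ≡ true
<ᵇ-true {y = y} {x} y<x with toℕ x ≤ᵇ toℕ y in x≤ᵇy
... | false = refl
... | true  = contradiction (≤ᵇ⇒≤ _ _ (from T-≡ x≤ᵇy)) (λ x≤y → <-irrefl refl (<-≤-trans y<x x≤y))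

<ᵇ-false : ∀ {n} {y x : Fin n} → toℕ x ≤ toℕ y → (y <ᵇ x) ≡ false
<ᵇ-false x≤y rewrite to T-≡ (≤⇒≤ᵇ x≤y) = refl

<ᵇ⇒< : ∀ {n} (y x : Fin n) → (y <ᵇ x) ≡ true → toℕ y < toℕ x
<ᵇ⇒< y x y<ᵇx with toℕ x ≤ᵇ toℕ y in x≤ᵇy
... | false = ≰⇒> (λ x≤y → contradiction (trans (sym (to T-≡ (≤⇒≤ᵇ x≤y))) x≤ᵇy) λ ())

<ᵇ-suc : ∀ {n} (y x : Fin n) → (suc y <ᵇ suc x) ≡ (y <ᵇ x)
<ᵇ-suc y x = cong not (≤ᵇ-suc (toℕ x) (toℕ y))
  where
  ≤ᵇ-suc : ∀ a b → (suc a ≤ᵇ suc b) ≡ (a ≤ᵇ b)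
  ≤ᵇ-suc zero    b = refl
  ≤ᵇ-suc (suc a) b = refl

<ᵇ-irrefl : ∀ {n} (x : Fin n) → (x <ᵇ x) ≡ false
<ᵇ-irrefl x = <ᵇ-false {y = x} {x} ≤-refl

<ᵇ-trans : ∀ {n} (a b c : Fin n) → (a <ᵇ b) ≡ true → (b <ᵇ c) ≡ true → (a <ᵇ c) ≡ true
<ᵇ-trans a b c a<b b<c = <ᵇ-true (<-trans (<ᵇ⇒< a b a<b) (<ᵇ⇒< b c b<c))

-- needs a universal quantifier, so the program stores it from initialisation on
isLast : ∀ {n} → Fin n → Bool
isLast {n} y = allFin {n} (λ z → toℕ z ≤ᵇ toℕ y)

isLast-sound : ∀ {n} (ℓ : Fin n) → isLast ℓ ≡ true → ∀ (y : Fin n) → toℕ y ≤ toℕ ℓ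
isLast-sound ℓ ℓ-last y =
  ≤ᵇ⇒≤ (toℕ y) (toℕ ℓ) (from T-≡ (allFin-elim (λ z → toℕ z ≤ᵇ toℕ ℓ) ℓ-last y))

last-exists : ∀ {n} → Fin n → Σ (Fin n) λ ℓ → isLast ℓ ≡ true
last-exists {suc m} _ = fromℕ m , allFin-intro (λ (z : Fin (suc m)) → toℕ z ≤ᵇ toℕ (fromℕ m))
  (λ y → to T-≡ (≤⇒≤ᵇ (subst (toℕ y ≤_) (sym (toℕ-fromℕ m)) (toℕ≤pred[n] y))))

-- Subwords

mask : ∀ {k n} → (Fin n → Bool) → Word k n → Word k n
mask P w y = if P y then w y else nothing

sub : ∀ {k n} → (Fin n → Bool) → Word k n → List (Fin k)
sub P w = wordList (mask P w)

_∩<_ _∩>_ : ∀ {n} → (Fin n → Bool) → Fin n → Fin n → Bool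
(P ∩< x) y = P y ∧ y <ᵇ x
(P ∩> x) y = P y ∧ x <ᵇ y

wordList-cons : ∀ {k n} (w : Word k (suc n)) → wordList w ≡ fromMaybe (w zero) ++ wordList (tail w)
wordList-cons w with w zero
... | nothing = refl
... | just a  = refl

wordList-cong : ∀ {k n} {w w′ : Word k n} → (∀ y → w y ≡ w′ y) → wordList w ≡ wordList w′
wordList-cong {n = zero}  w≗w′ = refl
wordList-cong {n = suc n} {w} {w′} w≗w′ = begin
  wordList w
    ≡⟨ wordList-cons w ⟩
  fromMaybe (w zero) ++ wordList (tail w)
    ≡⟨ cong₂ (λ m l → fromMaybe m ++ l) (w≗w′ zero) (wordList-cong (λ y → w≗w′ (suc y))) ⟩
  fromMaybe (w′ zero) ++ wordList (tail w′)
    ≡⟨ wordList-cons w′ ⟨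
  wordList w′ ∎
  where open ≡-Reasoning

blank : ∀ {k n} → Word k n
blank _ = nothing

wordList-blank : ∀ {k n} → wordList (blank {k} {n}) ≡ []
wordList-blank {n = zero}  = refl
wordList-blank {n = suc n} = wordList-blank {n = n}

sub-cons : ∀ {k n} (P : Fin (suc n) → Bool) (w : Word k (suc n)) →
  sub P w ≡ fromMaybe (mask P w zero) ++ sub (tail P) (tail w)
sub-cons P w = wordList-cons (mask P w)

sub-cong : ∀ {k n} {P Q : Fin n → Bool} (w : Word k n) → (∀ y → P y ≡ Q y) → sub P w ≡ sub Q w
sub-cong w P≗Q = wordList-cong (λ y → cong (λ b → if b then w y else nothing) (P≗Q y))

sub-empty : ∀ {k n} (P : Fin n → Bool) (w : Word k n) → (∀ y → P y ≡ false) → sub P w ≡ []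
sub-empty {n = n} P w P≗false = trans (sub-cong w P≗false) (wordList-blank {n = n})

sub-single : ∀ {k n} (z : Fin n) (w : Word k n) → sub (λ y → ⌊ y ≟ z ⌋) w ≡ fromMaybe (w z)
sub-single zero w = begin
  sub (λ y → ⌊ y ≟ zero ⌋) w
    ≡⟨ sub-cons (λ y → ⌊ y ≟ zero ⌋) w ⟩
  fromMaybe (w zero) ++ sub (λ _ → false) (tail w)
    ≡⟨ cong (fromMaybe (w zero) ++_) (sub-empty _ (tail w) (λ _ → refl)) ⟩
  fromMaybe (w zero) ++ []
    ≡⟨ ++-identityʳ (fromMaybe (w zero)) ⟩
  fromMaybe (w zero) ∎
  where open ≡-Reasoning
sub-single (suc z) w =
  trans (sub-cons (λ y → ⌊ y ≟ suc z ⌋) w)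
        (trans (sub-cong (tail w) (λ y → ≟-suc y z)) (sub-single z (tail w)))

sub-blank : ∀ {k n} (P : Fin n → Bool) → sub P (blank {k} {n}) ≡ []
sub-blank {k} {n} P = trans (wordList-cong (λ y → blankMask (P y))) (wordList-blank {k} {n})
  where
  blankMask : ∀ b → (if b then nothing else nothing) ≡ nothing {A = Fin k}
  blankMask true  = refl
  blankMask false = refl

wordList-setWord-blank : ∀ {k n} (c : Maybe (Fin k)) (y : Fin n) →
  wordList (setWord (c , y) blank) ≡ wordList {k} {1} (λ _ → c)
-- setWord (c , y) blank is, definitionally, the constant word c masked to the position y
wordList-setWord-blank c y = trans (sub-single y (λ _ → c)) (single c)
  where
  single : ∀ c → fromMaybe c ≡ wordList {n = 1} (λ _ → c)
  single nothing  = refl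
  single (just a) = refl

mask-just : ∀ {k n} (P : Fin n → Bool) (w : Word k n) y {c} → mask P w y ≡ just c → P y ≡ true × w y ≡ just c
mask-just P w y m≡c with P y
... | true = refl , m≡c

sub-∩<-zero : ∀ {k n} (P : Fin (suc n) → Bool) (w : Word k (suc n)) → sub (P ∩< zero) w ≡ []
sub-∩<-zero P w = sub-empty _ w (λ y → ∧-zeroʳ (P y))

sub-∩>-zero : ∀ {k n} (P : Fin (suc n) → Bool) (w : Word k (suc n)) → sub (P ∩> zero) w ≡ sub (tail P) (tail w)
sub-∩>-zero P w =
  trans (sub-cons (P ∩> zero) w)
        (cong₂ (λ b l → fromMaybe (if b then w zero else nothing) ++ l) (∧-zeroʳ (P zero))
               (sub-cong (tail w) (λ y → ∧-identityʳ (P (suc y)))))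

sub-∩<-suc : ∀ {k n} (P : Fin (suc n) → Bool) (w : Word k (suc n)) x →
  sub (P ∩< suc x) w ≡ fromMaybe (mask P w zero) ++ sub (tail P ∩< x) (tail w)
sub-∩<-suc P w x =
  trans (sub-cons (P ∩< suc x) w)
        (cong₂ (λ b l → fromMaybe (if b then w zero else nothing) ++ l) (∧-identityʳ (P zero))
               (sub-cong (tail w) (λ y → cong (P (suc y) ∧_) (<ᵇ-suc y x))))

sub-∩>-suc : ∀ {k n} (P : Fin (suc n) → Bool) (w : Word k (suc n)) x →
  sub (P ∩> suc x) w ≡ sub (tail P ∩> x) (tail w)
sub-∩>-suc P w x =
  trans (sub-cons (P ∩> suc x) w)
        (cong₂ (λ b l → fromMaybe (if b then w zero else nothing) ++ l) (∧-zeroʳ (P zero))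
               (sub-cong (tail w) (λ y → cong (P (suc y) ∧_) (<ᵇ-suc x y))))

sub-pivot : ∀ {k n} (P : Fin n → Bool) (w : Word k n) x → P x ≡ true →
  sub P w ≡ sub (P ∩< x) w ++ fromMaybe (w x) ++ sub (P ∩> x) w
sub-pivot P w zero Px = begin
  sub P w
    ≡⟨ sub-cons P w ⟩
  fromMaybe (mask P w zero) ++ sub (tail P) (tail w)
    ≡⟨ cong₂ (λ b l → fromMaybe (if b then w zero else nothing) ++ l) Px (sym (sub-∩>-zero P w)) ⟩
  fromMaybe (w zero) ++ sub (P ∩> zero) w
    ≡⟨ cong (_++ fromMaybe (w zero) ++ sub (P ∩> zero) w) (sub-∩<-zero P w) ⟨
  sub (P ∩< zero) w ++ fromMaybe (w zero) ++ sub (P ∩> zero) w ∎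
  where open ≡-Reasoning
sub-pivot P w (suc x) Px = begin
  sub P w
    ≡⟨ sub-cons P w ⟩
  m₀ ++ sub (tail P) (tail w)
    ≡⟨ cong (m₀ ++_) (sub-pivot (tail P) (tail w) x Px) ⟩
  m₀ ++ sub (tail P ∩< x) (tail w) ++ mid
    ≡⟨ ++-assoc m₀ _ mid ⟨
  (m₀ ++ sub (tail P ∩< x) (tail w)) ++ mid
    ≡⟨ cong₂ (λ l r → l ++ fromMaybe (w (suc x)) ++ r) (sub-∩<-suc P w x) (sub-∩>-suc P w x) ⟨
  sub (P ∩< suc x) w ++ fromMaybe (w (suc x)) ++ sub (P ∩> suc x) w ∎
  where
  open ≡-Reasoning
  m₀  = fromMaybe (mask P w zero)
  mid = fromMaybe (w (suc x)) ++ sub (tail P ∩> x) (tail w)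

Split : ∀ {k n} → (Fin n → Bool) → Word k n → List (Fin k) → Fin k → List (Fin k) → Set
Split P w u a v = ∃[ x ] P x ≡ true × w x ≡ just a × sub (P ∩< x) w ≡ u × sub (P ∩> x) w ≡ v

split-suc : ∀ {k n} {P : Fin (suc n) → Bool} {w : Word k (suc n)} {pre u a v} →
  fromMaybe (mask P w zero) ≡ pre → Split (tail P) (tail w) u a v → Split P w (pre ++ u) a v
split-suc {P = P} {w} m₀≡pre (x , Px , wx , before , after) =
  suc x , Px , wx , trans (sub-∩<-suc P w x) (cong₂ _++_ m₀≡pre before) , trans (sub-∩>-suc P w x) after

sub-split : ∀ {k n} (P : Fin n → Bool) (w : Word k n) u a v → sub P w ≡ u ++ a ∷ v → Split P w u a v
sub-split {n = zero}  P w []      a v ()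
sub-split {n = zero}  P w (_ ∷ _) a v ()
sub-split {n = suc n} P w u a v P≡uav = cases (mask P w zero) refl u refl
  where
  tail≡ : fromMaybe (mask P w zero) ++ sub (tail P) (tail w) ≡ u ++ a ∷ v
  tail≡ = trans (sym (sub-cons P w)) P≡uav
  cases : ∀ m → mask P w zero ≡ m → ∀ u′ → u ≡ u′ → Split P w u a v
  headIs : ∀ {m} → mask P w zero ≡ m → fromMaybe m ++ sub (tail P) (tail w) ≡ u ++ a ∷ v
  headIs m₀≡ = subst (λ m → fromMaybe m ++ sub (tail P) (tail w) ≡ u ++ a ∷ v) m₀≡ tail≡
  cases nothing m₀≡ _ _ =
    split-suc (cong fromMaybe m₀≡) (sub-split (tail P) (tail w) u a v (headIs m₀≡))
  cases (just c) m₀≡ [] refl =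
    let c≡a , rest≡v = ∷-injective (headIs m₀≡)
        P0 , w0 = mask-just P w zero m₀≡
    in zero , P0 , trans w0 (cong just c≡a) , sub-∩<-zero P w , trans (sub-∩>-zero P w) rest≡v
  cases (just c) m₀≡ (c′ ∷ u′) refl =
    let c≡c′ , rest≡ = ∷-injective (headIs m₀≡)
    in split-suc (cong fromMaybe (trans m₀≡ (cong just c≡c′))) (sub-split (tail P) (tail w) u′ a v rest≡)

setWord-at : ∀ {k n} (w : Word k n) β z → setWord (β , z) w z ≡ β
setWord-at w β z rewrite ≟-refl z = refl

sub-setWord-outside : ∀ {k n} (P : Fin n → Bool) (w : Word k n) β z → P z ≡ false →
  sub P (setWord (β , z) w) ≡ sub P w
sub-setWord-outside P w β z Pz = wordList-cong masked
  where
  masked : ∀ y → mask P (setWord (β , z) w) y ≡ mask P w y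
  masked y with y ≟ z
  ... | yes refl rewrite Pz = refl
  ... | no  _    = refl

-- Prefix values in a group language

module GroupValues {k : ℕ} (L : GroupLang k) where
  open GroupLang L public
  open FinGroup G public
  open IsGroup isGroup using (assoc; identityˡ; identityʳ; inverseˡ)

  infixl 7 _·_
  _·_ : Fin m → Fin m → Fin m
  _·_ = _∙_

  inv : Fin m → Fin m
  inv = _⁻¹

  homLetter : Maybe (Fin k) → Fin m
  homLetter nothing  = e
  homLetter (just a) = h a

  hom-++ : ∀ (xs ys : List (Fin k)) → hom (xs ++ ys) ≡ hom xs · hom ys
  hom-++ []       ys = sym (identityˡ (hom ys))
  hom-++ (x ∷ xs) ys = trans (cong (h x ·_) (hom-++ xs ys)) (sym (assoc (h x) (hom xs) (hom ys)))

  hom-fromMaybe : ∀ c → hom (fromMaybe c) ≡ homLetter c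
  hom-fromMaybe nothing  = refl
  hom-fromMaybe (just a) = identityʳ (h a)

  hom-pivot : ∀ {n} (P : Fin n → Bool) (w : Word k n) x → P x ≡ true →
    hom (sub P w) ≡ hom (sub (P ∩< x) w) · (homLetter (w x) · hom (sub (P ∩> x) w))
  hom-pivot P w x Px = begin
    hom (sub P w)
      ≡⟨ cong hom (sub-pivot P w x Px) ⟩
    hom (sub (P ∩< x) w ++ fromMaybe (w x) ++ sub (P ∩> x) w)
      ≡⟨ hom-++ (sub (P ∩< x) w) _ ⟩
    hom (sub (P ∩< x) w) · hom (fromMaybe (w x) ++ sub (P ∩> x) w)
      ≡⟨ cong (hom (sub (P ∩< x) w) ·_) (hom-++ (fromMaybe (w x)) _) ⟩
    hom (sub (P ∩< x) w) · (hom (fromMaybe (w x)) · hom (sub (P ∩> x) w))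
      ≡⟨ cong (λ g → hom (sub (P ∩< x) w) · (g · hom (sub (P ∩> x) w))) (hom-fromMaybe (w x)) ⟩
    hom (sub (P ∩< x) w) · (homLetter (w x) · hom (sub (P ∩> x) w)) ∎
    where open ≡-Reasoning

  isolate : ∀ a b c d → a ≡ b · (c · d) → d ≡ inv (b · c) · a
  isolate a b c d a≡ = sym (begin
    inv (b · c) · a              ≡⟨ cong (inv (b · c) ·_) (trans a≡ (sym (assoc b c d))) ⟩
    inv (b · c) · ((b · c) · d)  ≡⟨ sym (assoc _ _ d) ⟩
    (inv (b · c) · (b · c)) · d  ≡⟨ cong (_· d) (inverseˡ (b · c)) ⟩
    e · d                       ≡⟨ identityˡ d ⟩
    d                           ∎)
    where open ≡-Reasoning

  prefix : ∀ {n} → Word k n → Fin n → Fin m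
  prefix w y = hom (sub (_<ᵇ y) w)

  _▸_ : Fin m → Maybe (Fin k) → Fin m
  p ▸ c = p · homLetter c

  ·-▸-assoc : ∀ a b c → (a · b) ▸ c ≡ a · (b ▸ c)
  ·-▸-assoc a b c = assoc a b (homLetter c)

  prefix-split : ∀ {n} (w : Word k n) (s x : Fin n) → (s <ᵇ x) ≡ true →
    prefix w x ≡ prefix w s · (homLetter (w s) · hom (sub ((s <ᵇ_) ∩< x) w))
  prefix-split w s x s<x =
    trans (hom-pivot (_<ᵇ x) w s s<x)
          (cong₂ (λ l r → hom l · (homLetter (w s) · hom r))
                 (sub-cong w before) (sub-cong w (λ y → ∧-comm (y <ᵇ x) (s <ᵇ y))))
    where
    before : ∀ y → (y <ᵇ x ∧ y <ᵇ s) ≡ (y <ᵇ s)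
    before y with y <ᵇ s in y<s
    ... | true  = trans (∧-identityʳ (y <ᵇ x)) (<ᵇ-trans y s x y<s s<x)
    ... | false = ∧-zeroʳ (y <ᵇ x)

  hom-window : ∀ {n} (w : Word k n) (s x : Fin n) → (s <ᵇ x) ≡ true →
    hom (sub ((s <ᵇ_) ∩< x) w) ≡ inv (prefix w s ▸ w s) · prefix w x
  hom-window w s x s<x = isolate _ _ _ _ (prefix-split w s x s<x)

  hom-suffix : ∀ {n} (w : Word k n) (s : Fin n) → hom (sub (s <ᵇ_) w) ≡ inv (prefix w s ▸ w s) · hom (wordList w)
  hom-suffix w s = isolate _ _ _ _ (hom-pivot (λ _ → true) w s refl)

  hom-last : ∀ {n} (w : Word k n) (ℓ : Fin n) → (∀ y → toℕ y ≤ toℕ ℓ) →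
    hom (wordList w) ≡ prefix w ℓ ▸ w ℓ
  hom-last w ℓ ℓ-last = begin
    hom (wordList w)
      ≡⟨ hom-pivot (λ _ → true) w ℓ refl ⟩
    prefix w ℓ · (homLetter (w ℓ) · hom (sub (ℓ <ᵇ_) w))
      ≡⟨ cong (λ l → prefix w ℓ · (homLetter (w ℓ) · hom l)) (sub-empty _ w (λ y → <ᵇ-false (ℓ-last y))) ⟩
    prefix w ℓ · (homLetter (w ℓ) · e)
      ≡⟨ cong (prefix w ℓ ·_) (identityʳ (homLetter (w ℓ))) ⟩
    prefix w ℓ ▸ w ℓ ∎
    where open ≡-Reasoning

  prefixAfterSet : Fin m → Maybe (Fin k) → Maybe (Fin k) → Bool → Fin m → Fin m
  prefixAfterSet pz α β b py = if b then (pz ▸ β) · (inv (pz ▸ α) · py) else py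

  prefix-setWord : ∀ {n} (w : Word k n) β z y →
    prefix (setWord (β , z) w) y ≡ prefixAfterSet (prefix w z) (w z) β (z <ᵇ y) (prefix w y)
  prefix-setWord w β z y with z <ᵇ y in z<y
  ... | false = cong hom (sub-setWord-outside (_<ᵇ y) w β z z<y)
  ... | true  = begin
    prefix w′ y
      ≡⟨ prefix-split w′ z y z<y ⟩
    prefix w′ z · (homLetter (w′ z) · hom (sub window w′))
      ≡⟨ cong₂ (λ p l → p · (homLetter (w′ z) · hom l))
        (cong hom (sub-setWord-outside (_<ᵇ z) w β z (<ᵇ-irrefl z)))
        (sub-setWord-outside window w β z (cong (_∧ z <ᵇ y) (<ᵇ-irrefl z))) ⟩
    prefix w z · (homLetter (w′ z) · hom (sub window w))
      ≡⟨ cong (λ c → prefix w z · (homLetter c · hom (sub window w))) (setWord-at w β z) ⟩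
    prefix w z · (homLetter β · hom (sub window w))
      ≡⟨ cong (λ g → prefix w z · (homLetter β · g)) (hom-window w z y z<y) ⟩
    prefix w z · (homLetter β · (inv (prefix w z ▸ w z) · prefix w y))
      ≡⟨ sym (assoc _ _ _) ⟩
    (prefix w z ▸ β) · (inv (prefix w z ▸ w z) · prefix w y) ∎
    where
    open ≡-Reasoning
    w′ = setWord (β , z) w
    window = (z <ᵇ_) ∩< y

-- Group monomials evaluated on words with ε-positions

isLetter-sound : ∀ {k} (c : Maybe (Fin k)) a → isLetter c a ≡ true → c ≡ just a
isLetter-sound (just b) a b≟a = cong just (≟-sound b a b≟a)

isLetter-refl : ∀ {k} (a : Fin k) → isLetter (just a) a ≡ true
isLetter-refl = ≟-refl

after : ∀ {n} → Maybe (Fin n) → Fin n → Bool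
after nothing  y = true
after (just s) y = s <ᵇ y

after-∩> : ∀ {n} (lo : Maybe (Fin n)) x y → after lo x ≡ true → (after lo ∩> x) y ≡ (x <ᵇ y)
after-∩> nothing  x y _ = refl
after-∩> (just s) x y s<x with x <ᵇ y in x<y
... | true  = trans (∧-identityʳ (s <ᵇ y)) (<ᵇ-trans s x y s<x x<y)
... | false = ∧-zeroʳ (s <ᵇ y)

module _ {k : ℕ} where
  open GroupLang using (F; hom)

  letterStep : ∀ {n} → GroupLang k → Fin k → Maybe (Fin n) → Word k n → Fin n → Bool
  letterStep L a lo w x = after lo x ∧ (isLetter (w x) a ∧ F L (hom L (sub (after lo ∩< x) w)))

  monoAccepts : ∀ {n} → GroupLang k → List (Fin k × GroupLang k) → Maybe (Fin n) → Word k n → Bool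
  monoAccepts L []             lo w = F L (hom L (sub (after lo) w))
  monoAccepts L ((a , L′) ∷ r) lo w = anyFin (λ x → letterStep L a lo w x ∧ monoAccepts L′ r (just x) w)

  monoAccepts-sound : ∀ {n} L r (lo : Maybe (Fin n)) (w : Word k n) →
    monoAccepts L r lo w ≡ true → monoLang L r (sub (after lo) w)
  monoAccepts-sound L []             lo w acc = acc
  monoAccepts-sound L ((a , L′) ∷ r) lo w acc =
    let x , step∧rest = anyFin-elim _ acc
        step , rest   = ∧-elim {letterStep L a lo w x} step∧rest
        lo<x , here   = ∧-elim {after lo x} step
        wx≡a , window = ∧-elim {isLetter (w x) a} here
    in sub (after lo ∩< x) w , sub (x <ᵇ_) w ,
       trans (sub-pivot (after lo) w x lo<x)
             (cong₂ (λ c v → sub (after lo ∩< x) w ++ fromMaybe c ++ v) (isLetter-sound (w x) a wx≡a)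
                    (sub-cong w (λ y → after-∩> lo x y lo<x))) ,
       window , monoAccepts-sound L′ r (just x) w rest

  monoAccepts-complete : ∀ {n} L r (lo : Maybe (Fin n)) (w : Word k n) →
    monoLang L r (sub (after lo) w) → monoAccepts L r lo w ≡ true
  monoAccepts-complete L []             lo w u∈L = u∈L
  monoAccepts-complete L ((a , L′) ∷ r) lo w (u , v , w≡uav , u∈L , v∈M) =
    let x , lo<x , wx≡a , before , after-x = sub-split (after lo) w u a v w≡uav
        v≡ : sub (after (just x)) w ≡ v
        v≡ = trans (sub-cong w (λ y → sym (after-∩> lo x y lo<x))) after-x
        step : letterStep L a lo w x ≡ true
        step = ∧-intro lo<x (∧-intro (trans (cong (λ c → isLetter c a) wx≡a) (isLetter-refl a))
                                     (trans (cong (λ u → F L (hom L u)) before) u∈L))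
    in anyFin-intro _ x (∧-intro step (monoAccepts-complete L′ r (just x) w (subst (monoLang L′ r) (sym v≡) v∈M)))

  monoAccepts-correct : ∀ {n} L r (w : Word k n) → (monoAccepts L r nothing w ≡ true) ⇔ monoLang L r (wordList w)
  monoAccepts-correct L r w = mk⇔ (monoAccepts-sound L r nothing w) (monoAccepts-complete L r nothing w)

  accepts : ∀ {n} → BoolComb k → Word k n → Bool
  accepts (atom (mono L r)) w = monoAccepts L r nothing w
  accepts (neg B)           w = not (accepts B w)
  accepts (conj B C)        w = accepts B w ∧ accepts C w
  accepts (disj B C)        w = accepts B w ∨ accepts C w

  accepts-correct : ∀ {n} (B : BoolComb k) (w : Word k n) → (accepts B w ≡ true) ⇔ ⟦ B ⟧B (wordList w)
  accepts-correct (atom (mono L r)) w = monoAccepts-correct L r w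
  accepts-correct (neg B) w with accepts B w | accepts-correct B w
  ... | true  | B⇔ = mk⇔ (λ ()) (λ ¬B → ⊥-elim (¬B (to B⇔ refl)))
  ... | false | B⇔ = mk⇔ (λ _ b → case from B⇔ b of λ ()) (λ _ → refl)
  accepts-correct (conj B C) w = mk⇔
    (λ acc → let b , c = ∧-elim {accepts B w} acc in to (accepts-correct B w) b , to (accepts-correct C w) c)
    (λ (b , c) → ∧-intro (from (accepts-correct B w) b) (from (accepts-correct C w) c))
  accepts-correct (disj B C) w with accepts B w | accepts-correct B w
  ... | true  | B⇔ = mk⇔ (λ _ → inj₁ (to B⇔ refl)) (λ _ → refl)
  ... | false | B⇔ = mk⇔ (λ c → inj₂ (to (accepts-correct C w) c))
                         (λ { (inj₁ b) → case from B⇔ b of λ () ; (inj₂ c) → from (accepts-correct C w) c })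

  monoAccepts-wordList : ∀ {n n′} L r (w : Word k n) (w′ : Word k n′) → wordList w ≡ wordList w′ →
    monoAccepts L r nothing w ≡ monoAccepts L r nothing w′
  monoAccepts-wordList L r w w′ w≡w′ =
    Bool-≡-via-⇔ (subst (λ u → (monoAccepts L r nothing w ≡ true) ⇔ monoLang L r u) w≡w′
                        (monoAccepts-correct L r w))
                 (monoAccepts-correct L r w′)

  accepts-wordList : ∀ {n n′} B (w : Word k n) (w′ : Word k n′) → wordList w ≡ wordList w′ →
    accepts B w ≡ accepts B w′
  accepts-wordList B w w′ w≡w′ =
    Bool-≡-via-⇔ (subst (λ u → (accepts B w ≡ true) ⇔ ⟦ B ⟧B u) w≡w′ (accepts-correct B w))
                 (accepts-correct B w′)

-- Finite data stored in unary relations, one bit per relation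

data Code : Set where
  bool   : Code
  fin    : ℕ → Code
  letter : ℕ → Code
  bits   : ℕ → Code
  _⊗_    : Code → Code → Code

El : Code → Set
El bool       = Bool
El (fin m)    = Fin m
El (letter k) = Maybe (Fin k)
El (bits N)   = Vec Bool N
El (A ⊗ B)    = El A × El B

width : Code → ℕ
width bool       = 1
width (fin m)    = m
width (letter k) = k
width (bits N)   = N
width (A ⊗ B)    = width A + width B

encode : ∀ C → El C → Vec Bool (width C)
encode bool       b       = b ∷ []
encode (fin m)    x       = tabulate (λ j → ⌊ x ≟ j ⌋)
encode (letter k) c       = tabulate (isLetter c)
encode (bits N)   v       = v
encode (A ⊗ B)    (a , b) = encode A a ++ᵛ encode B b

-- a formula that branches on a value of type A, read off the structure by atoms
Reader : ℕ → ℕ → ℕ → ℕ → Set → Set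
Reader k a0 a1 v A = (A → QF k a0 a1 v) → QF k a0 a1 v

module _ {k a0 a1 v : ℕ} where

  _⊛_ : ∀ {A C} → Reader k a0 a1 v A → Reader k a0 a1 v C → Reader k a0 a1 v (A × C)
  (R ⊛ R′) K = R λ a → R′ λ c → K (a , c)

  mapReader : ∀ {A C} → (A → C) → Reader k a0 a1 v A → Reader k a0 a1 v C
  mapReader f R K = R (K ∘ f)

  constQF : Bool → QF k a0 a1 v
  constQF true  = tt
  constQF false = neg tt

  ask : Atom k a0 a1 v → Reader k a0 a1 v Bool
  ask α K = disj (conj (atom α) (K true)) (conj (neg (atom α)) (K false))

  askVec : ∀ {N} → (Fin N → Atom k a0 a1 v) → Reader k a0 a1 v (Vec Bool N)
  askVec {N = zero}  αs K = K []
  askVec {N = suc N} αs K = ask (αs zero) λ b → askVec (tail αs) (K ∘ (b ∷_))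

  -- reads a one-hot encoded optional value, all bits off encoding nothing
  askMaybeFin : ∀ {m} → (Fin m → Atom k a0 a1 v) → Reader k a0 a1 v (Maybe (Fin m))
  askMaybeFin {m = zero}  αs K = K nothing
  askMaybeFin {m = suc m} αs K =
    ask (αs zero) λ b → if b then K (just zero) else askMaybeFin (tail αs) (K ∘ mapMaybe suc)

  -- for fin m, an all-off reading encodes no element and is sent to the junk branch neg tt
  askCode : ∀ C → (Fin (width C) → Atom k a0 a1 v) → Reader k a0 a1 v (El C)
  askCode bool       αs   = ask (αs zero)
  askCode (fin m)    αs K = askMaybeFin αs (maybe K (neg tt))
  askCode (letter m) αs   = askMaybeFin αs
  askCode (bits N)   αs   = askVec αs
  askCode (A ⊗ C)    αs   = askCode A (αs ∘ (_↑ˡ width C)) ⊛ askCode C (αs ∘ (width A ↑ʳ_))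

module _ {k a0 a1 n v : ℕ} (S : Str k a0 a1 n) (ρ : Fin v → Fin n) where

  record Reads {A : Set} (R : Reader k a0 a1 v A) (a : A) : Set where
    constructor reading
    field read : ∀ K → evalQF S ρ (R K) ≡ evalQF S ρ (K a)
  open Reads public

  ⊛-reads : ∀ {A C} {R : Reader k a0 a1 v A} {R′ : Reader k a0 a1 v C} {a c} →
    Reads R a → Reads R′ c → Reads (R ⊛ R′) (a , c)
  ⊛-reads {R′ = R′} R-a R′-c =
    reading λ K → trans (read R-a (λ a → R′ λ c → K (a , c))) (read R′-c (λ c → K (_ , c)))

  mapReader-reads : ∀ {A C} (f : A → C) {R : Reader k a0 a1 v A} {a} → Reads R a → Reads (mapReader f R) (f a)
  mapReader-reads f R-a = reading λ K → read R-a (K ∘ f)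

  constQF-eval : ∀ b → evalQF S ρ (constQF b) ≡ b
  constQF-eval true  = refl
  constQF-eval false = refl

  ask-reads : ∀ α → Reads (ask α) (evalAtom S ρ α)
  read (ask-reads α) K with evalAtom S ρ α
  ... | true  = ∨-identityʳ _
  ... | false = refl

  askVec-reads : ∀ {N} (αs : Fin N → Atom k a0 a1 v) → Reads (askVec αs) (tabulate (evalAtom S ρ ∘ αs))
  read (askVec-reads {N = zero}  αs) K = refl
  read (askVec-reads {N = suc N} αs) K =
    trans (read (ask-reads (αs zero)) (λ b → askVec (tail αs) (K ∘ (b ∷_))))
          (read (askVec-reads (tail αs)) (K ∘ (evalAtom S ρ (αs zero) ∷_)))

  askMaybeFin-reads : ∀ {m} (αs : Fin m → Atom k a0 a1 v) c → (∀ j → evalAtom S ρ (αs j) ≡ isLetter c j) →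
    Reads (askMaybeFin αs) c
  read (askMaybeFin-reads {m = zero}  αs nothing hot) K = refl
  read (askMaybeFin-reads {m = suc m} αs c hot) K =
    trans (read (ask-reads (αs zero)) branch) (trans (cong (evalQF S ρ ∘ branch) (hot zero)) (byValue c hot))
    where
    branch : Bool → QF k a0 a1 v
    branch b = if b then K (just zero) else askMaybeFin (tail αs) (K ∘ mapMaybe suc)
    byValue : ∀ c → (∀ j → evalAtom S ρ (αs j) ≡ isLetter c j) →
      evalQF S ρ (branch (isLetter c zero)) ≡ evalQF S ρ (K c)
    byValue nothing        hot = read (askMaybeFin-reads (tail αs) nothing (hot ∘ suc)) (K ∘ mapMaybe suc)
    byValue (just zero)    hot = refl
    byValue (just (suc a)) hot =
      read (askMaybeFin-reads (tail αs) (just a) (λ j → trans (hot (suc j)) (≟-suc a j))) (K ∘ mapMaybe suc)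

  askCode-reads : ∀ C (αs : Fin (width C) → Atom k a0 a1 v) x →
    (∀ j → evalAtom S ρ (αs j) ≡ lookup (encode C x) j) → Reads (askCode C αs) x
  read (askCode-reads bool αs x stored) K = trans (read (ask-reads (αs zero)) K) (cong (evalQF S ρ ∘ K) (stored zero))
  read (askCode-reads (fin m) αs x stored) K =
    read (askMaybeFin-reads αs (just x) (λ j → trans (stored j) (lookup∘tabulate _ j))) (maybe K (neg tt))
  askCode-reads (letter m) αs c stored =
    askMaybeFin-reads αs c (λ j → trans (stored j) (lookup∘tabulate _ j))
  read (askCode-reads (bits N) αs x stored) K =
    trans (read (askVec-reads αs) K) (cong (evalQF S ρ ∘ K) (trans (tabulate-cong stored) (tabulate∘lookup x)))
  askCode-reads (A ⊗ C) αs (a , c) stored =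
    ⊛-reads (askCode-reads A (αs ∘ (_↑ˡ width C)) a
              (λ j → trans (stored (j ↑ˡ width C)) (lookup-++ˡ (encode A a) (encode C c) j)))
            (askCode-reads C (αs ∘ (width A ↑ʳ_)) c
              (λ j → trans (stored (width A ↑ʳ j)) (lookup-++ʳ (encode A a) (encode C c) j)))

module _ {k a0 a1 : ℕ} where

  renameAtom : ∀ {v v′} → (Fin v → Fin v′) → Atom k a0 a1 v → Atom k a0 a1 v′
  renameAtom f (letter σ t) = letter σ (f t)
  renameAtom f (leq t u)    = leq (f t) (f u)
  renameAtom f (eq t u)     = eq (f t) (f u)
  renameAtom f (rel0 j)     = rel0 j
  renameAtom f (rel1 j t)   = rel1 j (f t)

  renameQF : ∀ {v v′} → (Fin v → Fin v′) → QF k a0 a1 v → QF k a0 a1 v′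
  renameQF f (atom α)   = atom (renameAtom f α)
  renameQF f tt         = tt
  renameQF f (neg φ)    = neg (renameQF f φ)
  renameQF f (conj φ ψ) = conj (renameQF f φ) (renameQF f ψ)
  renameQF f (disj φ ψ) = disj (renameQF f φ) (renameQF f ψ)

  renameAtom-eval : ∀ {n v v′} (S : Str k a0 a1 n) (ρ : Fin v′ → Fin n) (f : Fin v → Fin v′) α →
    evalAtom S ρ (renameAtom f α) ≡ evalAtom S (ρ ∘ f) α
  renameAtom-eval S ρ f (letter σ t) = refl
  renameAtom-eval S ρ f (leq t u)    = refl
  renameAtom-eval S ρ f (eq t u)     = refl
  renameAtom-eval S ρ f (rel0 j)     = refl
  renameAtom-eval S ρ f (rel1 j t)   = refl

  renameQF-eval : ∀ {n v v′} (S : Str k a0 a1 n) (ρ : Fin v′ → Fin n) (f : Fin v → Fin v′) φ →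
    evalQF S ρ (renameQF f φ) ≡ evalQF S (ρ ∘ f) φ
  renameQF-eval S ρ f (atom α)   = renameAtom-eval S ρ f α
  renameQF-eval S ρ f tt         = refl
  renameQF-eval S ρ f (neg φ)    = cong not (renameQF-eval S ρ f φ)
  renameQF-eval S ρ f (conj φ ψ) = cong₂ _∧_ (renameQF-eval S ρ f φ) (renameQF-eval S ρ f ψ)
  renameQF-eval S ρ f (disj φ ψ) = cong₂ _∨_ (renameQF-eval S ρ f φ) (renameQF-eval S ρ f ψ)

  conjEx : ∀ {v} → QF k a0 a1 v → ExFO k a0 a1 v → ExFO k a0 a1 v
  conjEx ψ (qf φ) = qf (conj ψ φ)
  conjEx ψ (ex φ) = ex (conjEx (renameQF suc ψ) φ)

  conjEx-eval : ∀ {n v} (S : Str k a0 a1 n) (ρ : Fin v → Fin n) ψ φ →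
    evalEx S ρ (conjEx ψ φ) ≡ (evalQF S ρ ψ ∧ evalEx S ρ φ)
  conjEx-eval S ρ ψ (qf φ) = refl
  conjEx-eval S ρ ψ (ex φ) =
    trans (anyFin-cong (λ d → trans (conjEx-eval S (ext d ρ) (renameQF suc ψ) φ)
                                    (cong (_∧ evalEx S (ext d ρ) φ) (renameQF-eval S (ext d ρ) suc ψ))))
          (anyFin-∧ˡ (evalQF S ρ ψ) (λ d → evalEx S (ext d ρ) φ))

  -- there is no atom without free variables, hence the quantifier
  constFO : ∀ {v} → Bool → FO k a0 a1 v
  constFO true  = all (atom (eq zero zero))
  constFO false = neg (constFO true)

  constFO-eval : ∀ {n v} (S : Str k a0 a1 n) (ρ : Fin v → Fin n) b → evalFO S ρ (constFO b) ≡ b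
  constFO-eval {n} S ρ true  = allFin-intro {n} (λ z → ⌊ z ≟ z ⌋) ≟-refl
  constFO-eval {n} S ρ false = cong not (constFO-eval S ρ true)

  ifFO : ∀ {v} → FO k a0 a1 v → FO k a0 a1 v → FO k a0 a1 v → FO k a0 a1 v
  ifFO c φ ψ = neg (conj (neg (conj c φ)) (neg (conj (neg c) ψ)))

  ifFO-eval : ∀ {n v} (S : Str k a0 a1 n) (ρ : Fin v → Fin n) c φ ψ →
    evalFO S ρ (ifFO c φ ψ) ≡ (if evalFO S ρ c then evalFO S ρ φ else evalFO S ρ ψ)
  ifFO-eval S ρ c φ ψ with evalFO S ρ c | evalFO S ρ φ | evalFO S ρ ψ
  ... | true  | true  | _     = refl
  ... | true  | false | _     = refl
  ... | false | _     | true  = refl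
  ... | false | _     | false = refl

mapMaybe-ext-suc : ∀ {n v} (ρ : Fin v → Fin n) d (lo : Maybe (Fin v)) →
  mapMaybe (ext d ρ) (mapMaybe suc lo) ≡ mapMaybe ρ lo
mapMaybe-ext-suc ρ d nothing  = refl
mapMaybe-ext-suc ρ d (just s) = refl

-- The data stored at a position y of the current word w

module _ {k : ℕ} where
  open GroupValues using (prefix; prefixAfterSet; prefix-setWord)

  groupOrder : GroupLang k → ℕ
  groupOrder L = FinGroup.m (GroupLang.G L)

  prefixCode : GroupLang k → List (Fin k × GroupLang k) → Code
  prefixCode L []             = fin (groupOrder L)
  prefixCode L ((_ , L′) ∷ r) = fin (groupOrder L) ⊗ prefixCode L′ r

  prefixes : ∀ {n} L r → Word k n → Fin n → El (prefixCode L r)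
  prefixes L []             w y = prefix L w y
  prefixes L ((_ , L′) ∷ r) w y = prefix L w y , prefixes L′ r w y

  prefixesAfterSet : ∀ L r → El (prefixCode L r) → Maybe (Fin k) → Maybe (Fin k) → Bool →
    El (prefixCode L r) → El (prefixCode L r)
  prefixesAfterSet L []             pz       α β b py       = prefixAfterSet L pz α β b py
  prefixesAfterSet L ((_ , L′) ∷ r) (pz , qz) α β b (py , qy) =
    prefixAfterSet L pz α β b py , prefixesAfterSet L′ r qz α β b qy

  prefixes-setWord : ∀ {n} L r (w : Word k n) β z y →
    prefixes L r (setWord (β , z) w) y ≡ prefixesAfterSet L r (prefixes L r w z) (w z) β (z <ᵇ y) (prefixes L r w y)
  prefixes-setWord L []             w β z y = prefix-setWord L w β z y
  prefixes-setWord L ((_ , L′) ∷ r) w β z y = cong₂ _,_ (prefix-setWord L w β z y) (prefixes-setWord L′ r w β z y)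

  prefixCodeB : BoolComb k → Code
  prefixCodeB (atom (mono L r)) = prefixCode L r
  prefixCodeB (neg B)           = prefixCodeB B
  prefixCodeB (conj B C)        = prefixCodeB B ⊗ prefixCodeB C
  prefixCodeB (disj B C)        = prefixCodeB B ⊗ prefixCodeB C

  prefixesB : ∀ {n} B → Word k n → Fin n → El (prefixCodeB B)
  prefixesB (atom (mono L r)) w y = prefixes L r w y
  prefixesB (neg B)           w y = prefixesB B w y
  prefixesB (conj B C)        w y = prefixesB B w y , prefixesB C w y
  prefixesB (disj B C)        w y = prefixesB B w y , prefixesB C w y

  prefixesBAfterSet : ∀ B → El (prefixCodeB B) → Maybe (Fin k) → Maybe (Fin k) → Bool →
    El (prefixCodeB B) → El (prefixCodeB B)
  prefixesBAfterSet (atom (mono L r)) pz        α β b py        = prefixesAfterSet L r pz α β b py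
  prefixesBAfterSet (neg B)           pz        α β b py        = prefixesBAfterSet B pz α β b py
  prefixesBAfterSet (conj B C)        (pz , qz) α β b (py , qy) =
    prefixesBAfterSet B pz α β b py , prefixesBAfterSet C qz α β b qy
  prefixesBAfterSet (disj B C)        (pz , qz) α β b (py , qy) =
    prefixesBAfterSet B pz α β b py , prefixesBAfterSet C qz α β b qy

  prefixesB-setWord : ∀ {n} B (w : Word k n) β z y →
    prefixesB B (setWord (β , z) w) y ≡ prefixesBAfterSet B (prefixesB B w z) (w z) β (z <ᵇ y) (prefixesB B w y)
  prefixesB-setWord (atom (mono L r)) w β z y = prefixes-setWord L r w β z y
  prefixesB-setWord (neg B)           w β z y = prefixesB-setWord B w β z y
  prefixesB-setWord (conj B C)        w β z y = cong₂ _,_ (prefixesB-setWord B w β z y) (prefixesB-setWord C w β z y)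
  prefixesB-setWord (disj B C)        w β z y = cong₂ _,_ (prefixesB-setWord B w β z y) (prefixesB-setWord C w β z y)

  toIndex : Maybe (Fin k) → Fin (suc k)
  toIndex nothing  = zero
  toIndex (just a) = suc a

  fromIndex : Fin (suc k) → Maybe (Fin k)
  fromIndex zero    = nothing
  fromIndex (suc a) = just a

  fromIndex-toIndex : ∀ c → fromIndex (toIndex c) ≡ c
  fromIndex-toIndex nothing  = refl
  fromIndex-toIndex (just a) = refl

  tableCode : BoolComb k → Code
  tableCode (atom _)   = bits (suc k)
  tableCode (neg B)    = tableCode B
  tableCode (conj B C) = tableCode B ⊗ tableCode C
  tableCode (disj B C) = tableCode B ⊗ tableCode C

  tables : ∀ {n} B → Word k n → Fin n → El (tableCode B)
  tables (atom (mono L r)) w y = tabulate (λ c → monoAccepts L r nothing (setWord (fromIndex c , y) w))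
  tables (neg B)           w y = tables B w y
  tables (conj B C)        w y = tables B w y , tables C w y
  tables (disj B C)        w y = tables B w y , tables C w y

  acceptsByTables : ∀ B → El (tableCode B) → Maybe (Fin k) → Bool
  acceptsByTables (atom _)   v       c = lookup v (toIndex c)
  acceptsByTables (neg B)    v       c = not (acceptsByTables B v c)
  acceptsByTables (conj B C) (u , v) c = acceptsByTables B u c ∧ acceptsByTables C v c
  acceptsByTables (disj B C) (u , v) c = acceptsByTables B u c ∨ acceptsByTables C v c

  acceptsByTables-correct : ∀ {n} B (w : Word k n) y c →
    acceptsByTables B (tables B w y) c ≡ accepts B (setWord (c , y) w)
  acceptsByTables-correct (atom (mono L r)) w y c =
    trans (lookup∘tabulate (λ c′ → monoAccepts L r nothing (setWord (fromIndex c′ , y) w)) (toIndex c))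
          (cong (λ c′ → monoAccepts L r nothing (setWord (c′ , y) w)) (fromIndex-toIndex c))
  acceptsByTables-correct (neg B)    w y c = cong not (acceptsByTables-correct B w y c)
  acceptsByTables-correct (conj B C) w y c = cong₂ _∧_ (acceptsByTables-correct B w y c) (acceptsByTables-correct C w y c)
  acceptsByTables-correct (disj B C) w y c = cong₂ _∨_ (acceptsByTables-correct B w y c) (acceptsByTables-correct C w y c)

  unitPrefixes : ∀ (L : GroupLang k) r → El (prefixCode L r)
  unitPrefixes L []             = FinGroup.e (GroupLang.G L)
  unitPrefixes L ((_ , L′) ∷ r) = FinGroup.e (GroupLang.G L) , unitPrefixes L′ r

  unitPrefixesB : ∀ (B′ : BoolComb k) → El (prefixCodeB B′)
  unitPrefixesB (atom (mono L r)) = unitPrefixes L r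
  unitPrefixesB (neg B′)          = unitPrefixesB B′
  unitPrefixesB (conj B′ C)       = unitPrefixesB B′ , unitPrefixesB C
  unitPrefixesB (disj B′ C)       = unitPrefixesB B′ , unitPrefixesB C

  prefixes-blank : ∀ {n} (L : GroupLang k) r (y : Fin n) → prefixes L r blank y ≡ unitPrefixes L r
  prefixes-blank L []             y = cong (GroupLang.hom L) (sub-blank (_<ᵇ y))
  prefixes-blank L ((_ , L′) ∷ r) y = cong₂ _,_ (cong (GroupLang.hom L) (sub-blank (_<ᵇ y))) (prefixes-blank L′ r y)

  prefixesB-blank : ∀ {n} (B′ : BoolComb k) (y : Fin n) → prefixesB B′ blank y ≡ unitPrefixesB B′
  prefixesB-blank (atom (mono L r)) y = prefixes-blank L r y
  prefixesB-blank (neg B′)          y = prefixesB-blank B′ y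
  prefixesB-blank (conj B′ C)       y = cong₂ _,_ (prefixesB-blank B′ y) (prefixesB-blank C y)
  prefixesB-blank (disj B′ C)       y = cong₂ _,_ (prefixesB-blank B′ y) (prefixesB-blank C y)

  letterTables : ∀ (B′ : BoolComb k) → El (tableCode B′)
  letterTables (atom (mono L r)) = tabulate λ c → monoAccepts L r nothing (λ (_ : Fin 1) → fromIndex c)
  letterTables (neg B′)          = letterTables B′
  letterTables (conj B′ C)       = letterTables B′ , letterTables C
  letterTables (disj B′ C)       = letterTables B′ , letterTables C

  tables-blank : ∀ {n} (B′ : BoolComb k) (y : Fin n) → tables B′ blank y ≡ letterTables B′
  tables-blank (atom (mono L r)) y = tabulate-cong λ c →
    monoAccepts-wordList L r (setWord (fromIndex c , y) blank) (λ (_ : Fin 1) → fromIndex c) (wordList-setWord-blank (fromIndex c) y)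
  tables-blank (neg B′)          y = tables-blank B′ y
  tables-blank (conj B′ C)       y = cong₂ _,_ (tables-blank B′ y) (tables-blank C y)
  tables-blank (disj B′ C)       y = cong₂ _,_ (tables-blank B′ y) (tables-blank C y)

-- The dynamic program for a Boolean combination B of group monomials

module Program {k : ℕ} (B : BoolComb k) where
  open GroupValues using (prefix; prefixAfterSet; prefix-setWord; hom-window; hom-suffix; hom-last)

  -- the letter is kept because the update formulas only see the new word
  Local : Code
  Local = bool ⊗ (letter k ⊗ prefixCodeB B)

  Stored : Code
  Stored = Local ⊗ tableCode B

  A1 : ℕ
  A1 = width Stored

  local : ∀ {n} → Word k n → Fin n → El Local
  local w y = isLast y , w y , prefixesB B w y

  stored : ∀ {n} → Word k n → Fin n → El Stored
  stored w y = local w y , tables B w y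

  storedLast : El Stored → Bool
  storedLast ((l , _ , _) , _) = l

  storedLetter : El Stored → Maybe (Fin k)
  storedLetter ((_ , c , _) , _) = c

  storedPrefixes : El Stored → El (prefixCodeB B)
  storedPrefixes ((_ , _ , p) , _) = p

  storedTables : El Stored → El (tableCode B)
  storedTables (_ , t) = t

  Q : ℕ → Set
  Q v = QF k 1 A1 v

  readStored : ∀ {v} → Fin v → Reader k 1 A1 v (El Stored)
  readStored t = askCode Stored (λ j → rel1 j t)

  readLetter : ∀ {v} → Fin v → Reader k 1 A1 v (Maybe (Fin k))
  readLetter t = askCode (letter k) (λ a → letter a t)

  readLess : ∀ {v} → Fin v → Fin v → Reader k 1 A1 v Bool
  readLess s t = mapReader not (ask (leq t s))

  readEq : ∀ {v} → Fin v → Fin v → Reader k 1 A1 v Bool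
  readEq s t = ask (eq s t)

  -- For a change at i and the position x whose stored data is recomputed:
  -- the stored data at x and i, the new letter at x, and i < x.
  Centre : Set
  Centre = El Stored × El Stored × Maybe (Fin k) × Bool

  -- For a further position t: its stored data, its new letter, i < t, x < t and t = x.
  Point : Set
  Point = El Stored × Maybe (Fin k) × Bool × Bool × Bool

  readCentre : ∀ {v} (xv iv : Fin v) → Reader k 1 A1 v Centre
  readCentre xv iv = readStored xv ⊛ (readStored iv ⊛ (readLetter xv ⊛ readLess iv xv))

  readPoint : ∀ {v} (xv iv t : Fin v) → Reader k 1 A1 v Point
  readPoint xv iv t = readStored t ⊛ (readLetter t ⊛ (readLess iv t ⊛ (readLess xv t ⊛ readEq t xv)))

  readBound : ∀ {v} (xv iv t : Fin v) → Maybe (Fin v) → Reader k 1 A1 v (Maybe (Point × Bool))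
  readBound xv iv t nothing  K = K nothing
  readBound xv iv t (just s)   = mapReader just (readPoint xv iv s ⊛ readLess s t)

  decideBy : ∀ {v} → (Centre → Point → Maybe (Point × Bool) → Bool) →
    Centre × Point × Maybe (Point × Bool) → Q v
  decideBy f (cd , pt , bd) = constQF (f cd pt bd)

  decide : ∀ {v} (xv iv t : Fin v) → Maybe (Fin v) → (Centre → Point → Maybe (Point × Bool) → Bool) → Q v
  decide xv iv t lo f =
    (readCentre xv iv ⊛ (readPoint xv iv t ⊛ readBound xv iv t lo)) (decideBy f)

  localAfterSet : Maybe (Fin k) → Centre → El Local
  localAfterSet σ (Dx , Di , cx , i<x) =
    storedLast Dx , cx , prefixesBAfterSet B (storedPrefixes Di) (storedLetter Di) σ i<x (storedPrefixes Dx)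

  aboveBound : Maybe (Point × Bool) → Bool
  aboveBound nothing          = true
  aboveBound (just (_ , s<t)) = s<t

  -- For a monomial whose first group language is L, on the new word with x set to c;
  -- g extracts the prefix value for L from the stored data.
  module Evaluation (L : GroupLang k) (g : El Stored → Fin (groupOrder L)) (σ c : Maybe (Fin k)) where
    open GroupValues L using (_·_; inv; _▸_; F)

    prefixTwiceSet : Centre → Point → Fin (groupOrder L)
    prefixTwiceSet (Dx , Di , cx , i<x) (D , _ , i<t , x<t , _) =
      prefixAfterSet L (prefixAfterSet L (g Di) (storedLetter Di) σ i<x (g Dx)) cx c x<t
                       (prefixAfterSet L (g Di) (storedLetter Di) σ i<t (g D))

    letterTwiceSet : Point → Maybe (Fin k)
    letterTwiceSet (_ , ct , _ , _ , t≡x) = if t≡x then c else ct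

    windowValue : Centre → Point → Maybe (Point × Bool) → Fin (groupOrder L)
    windowValue cd pt nothing         = prefixTwiceSet cd pt
    windowValue cd pt (just (ps , _)) = inv (prefixTwiceSet cd ps ▸ letterTwiceSet ps) · prefixTwiceSet cd pt

    stepBool : Fin k → Centre → Point → Maybe (Point × Bool) → Bool
    stepBool a cd pt bd = aboveBound bd ∧ (isLetter (letterTwiceSet pt) a ∧ F (windowValue cd pt bd))

    suffixValue : Centre → Point → Maybe (Point × Bool) → Fin (groupOrder L)
    suffixValue cd pt bd = windowValue cd pt bd ▸ letterTwiceSet pt

    endBool : Centre → Point → Maybe (Point × Bool) → Bool
    endBool cd pt bd = storedLast (proj₁ pt) ∧ F (suffixValue cd pt bd)

  monoFormula : ∀ {v} (σ c : Maybe (Fin k)) (xv iv : Fin v) (lo : Maybe (Fin v)) L r →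
    (El Stored → El (prefixCode L r)) → ExFO k 1 A1 v
  monoFormula σ c xv iv lo L [] g =
    ex (qf (decide (suc xv) (suc iv) zero (mapMaybe suc lo) (Evaluation.endBool L g σ c)))
  monoFormula σ c xv iv lo L ((a , L′) ∷ r) g =
    ex (conjEx (decide (suc xv) (suc iv) zero (mapMaybe suc lo) (Evaluation.stepBool L (proj₁ ∘ g) σ c a))
               (monoFormula σ c (suc xv) (suc iv) (just zero) L′ r (proj₂ ∘ g)))

  -- In the context (x ; i) of an update:
  localFormula : Maybe (Fin k) → Fin (width Local) → ExFO k 1 A1 2
  localFormula σ j = qf (readCentre zero (suc zero) λ cd → constQF (lookup (encode Local (localAfterSet σ cd)) j))

  tableFormulas : Maybe (Fin k) → ∀ B′ → (El Stored → El (prefixCodeB B′)) →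
    Vec (ExFO k 1 A1 2) (width (tableCode B′))
  tableFormulas σ (atom (mono L r)) g = tabulate (λ c → monoFormula σ (fromIndex c) zero (suc zero) nothing L r g)
  tableFormulas σ (neg B′)          g = tableFormulas σ B′ g
  tableFormulas σ (conj B′ C)       g = tableFormulas σ B′ (proj₁ ∘ g) ++ᵛ tableFormulas σ C (proj₂ ∘ g)
  tableFormulas σ (disj B′ C)       g = tableFormulas σ B′ (proj₁ ∘ g) ++ᵛ tableFormulas σ C (proj₂ ∘ g)

  updateFormulas : Maybe (Fin k) → Vec (ExFO k 1 A1 2) A1
  updateFormulas σ = tabulate (localFormula σ) ++ᵛ tableFormulas σ B storedPrefixes

  -- In the context (i) of an update:
  acceptFormula : Maybe (Fin k) → ExFO k 1 A1 1
  acceptFormula σ = qf (readStored zero λ D → constQF (acceptsByTables B (storedTables D) σ))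

  module Update {n} (w : Word k n) (σ : Maybe (Fin k)) (i : Fin n) (R0 : Fin 1 → Bool) (R1 : Fin A1 → Fin n → Bool)
                (R1-stored : ∀ j y → R1 j y ≡ lookup (encode Stored (stored w y)) j) where

    w′ : Word k n
    w′ = setWord (σ , i) w

    S′ : Str k 1 A1 n
    S′ = record { word = w′ ; r0 = R0 ; r1 = R1 }

    centreAt : Fin n → Centre
    centreAt x = stored w x , stored w i , w′ x , i <ᵇ x

    pointAt : Fin n → Fin n → Point
    pointAt x t = stored w t , w′ t , i <ᵇ t , x <ᵇ t , ⌊ t ≟ x ⌋

    boundAt : Fin n → Maybe (Fin n) → Fin n → Maybe (Point × Bool)
    boundAt x lo t = mapMaybe (λ s → pointAt x s , s <ᵇ t) lo

    module _ {v} (ρ : Fin v → Fin n) where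

      readStored-reads : ∀ t → Reads S′ ρ (readStored t) (stored w (ρ t))
      readStored-reads t = askCode-reads S′ ρ Stored (λ j → rel1 j t) _ (λ j → R1-stored j (ρ t))

      readLetter-reads : ∀ t → Reads S′ ρ (readLetter t) (w′ (ρ t))
      readLetter-reads t = askCode-reads S′ ρ (letter k) (λ a → letter a t) _ (λ a → sym (lookup∘tabulate _ a))

      readLess-reads : ∀ s t → Reads S′ ρ (readLess s t) (ρ s <ᵇ ρ t)
      readLess-reads s t = mapReader-reads S′ ρ not (ask-reads S′ ρ (leq t s))

      module _ (xv iv : Fin v) (ρiv≡i : ρ iv ≡ i) where

        readCentre-reads : Reads S′ ρ (readCentre xv iv) (centreAt (ρ xv))
        readCentre-reads =
          subst (λ j → Reads S′ ρ (readCentre xv iv) (stored w (ρ xv) , stored w j , w′ (ρ xv) , j <ᵇ ρ xv)) ρiv≡i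
          (⊛-reads S′ ρ (readStored-reads xv) (⊛-reads S′ ρ (readStored-reads iv)
            (⊛-reads S′ ρ (readLetter-reads xv) (readLess-reads iv xv))))

        readPoint-reads : ∀ t → Reads S′ ρ (readPoint xv iv t) (pointAt (ρ xv) (ρ t))
        readPoint-reads t =
          subst (λ j → Reads S′ ρ (readPoint xv iv t) (stored w (ρ t) , w′ (ρ t) , j <ᵇ ρ t , ρ xv <ᵇ ρ t , ⌊ ρ t ≟ ρ xv ⌋))
                ρiv≡i
          (⊛-reads S′ ρ (readStored-reads t) (⊛-reads S′ ρ (readLetter-reads t)
            (⊛-reads S′ ρ (readLess-reads iv t) (⊛-reads S′ ρ (readLess-reads xv t) (ask-reads S′ ρ (eq t xv))))))

        readBound-reads : ∀ t lo → Reads S′ ρ (readBound xv iv t lo) (boundAt (ρ xv) (mapMaybe ρ lo) (ρ t))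
        readBound-reads t nothing  = reading λ K → refl
        readBound-reads t (just s) = mapReader-reads S′ ρ just (⊛-reads S′ ρ (readPoint-reads s) (readLess-reads s t))

        decide-eval : ∀ t lo f →
          evalQF S′ ρ (decide xv iv t lo f) ≡
            f (centreAt (ρ xv)) (pointAt (ρ xv) (ρ t)) (boundAt (ρ xv) (mapMaybe ρ lo) (ρ t))
        decide-eval t lo f =
          trans (read (⊛-reads S′ ρ readCentre-reads (⊛-reads S′ ρ (readPoint-reads t) (readBound-reads t lo)))
                      (decideBy f))
                (constQF-eval S′ ρ _)

    module MonomialAt (L : GroupLang k) (g : El Stored → Fin (groupOrder L))
                      (g-prefix : ∀ y → g (stored w y) ≡ prefix L w y) (c : Maybe (Fin k)) (x : Fin n) where
      open GroupValues L using (_·_; inv; _▸_; hom; F; ·-▸-assoc)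
      open Evaluation L g σ c

      w″ : Word k n
      w″ = setWord (c , x) w′

      prefixTwiceSet-correct : ∀ t → prefixTwiceSet (centreAt x) (pointAt x t) ≡ prefix L w″ t
      prefixTwiceSet-correct t rewrite g-prefix x | g-prefix i | g-prefix t =
        sym (trans (prefix-setWord L w′ c x t)
                   (cong₂ (λ px pt → prefixAfterSet L px (w′ x) c (x <ᵇ t) pt)
                          (prefix-setWord L w σ i x) (prefix-setWord L w σ i t)))

      windowValue-correct : ∀ lo t → after lo t ≡ true →
        windowValue (centreAt x) (pointAt x t) (boundAt x lo t) ≡ hom (sub (after lo ∩< t) w″)
      windowValue-correct nothing  t _   = prefixTwiceSet-correct t
      windowValue-correct (just s) t s<t =
        trans (cong₂ (λ ps pt → inv (ps ▸ w″ s) · pt) (prefixTwiceSet-correct s) (prefixTwiceSet-correct t))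
              (sym (hom-window L w″ s t s<t))

      stepBool-correct : ∀ a lo t → stepBool a (centreAt x) (pointAt x t) (boundAt x lo t) ≡ letterStep L a lo w″ t
      stepBool-correct a nothing  t = cong (λ p → isLetter (w″ t) a ∧ F p) (windowValue-correct nothing t refl)
      stepBool-correct a (just s) t = ∧-congˡ-if (s <ᵇ t) λ s<t →
        cong (λ p → isLetter (w″ t) a ∧ F p) (windowValue-correct (just s) t s<t)

      suffixValue-correct : ∀ (lo : Maybe (Fin n)) ℓ → (∀ (y : Fin n) → toℕ y ≤ toℕ ℓ) →
        suffixValue (centreAt x) (pointAt x ℓ) (boundAt x lo ℓ) ≡ hom (sub (after lo) w″)
      suffixValue-correct nothing ℓ ℓ-last = begin
        prefixTwiceSet (centreAt x) (pointAt x ℓ) ▸ w″ ℓ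
          ≡⟨ cong (_▸ w″ ℓ) (prefixTwiceSet-correct ℓ) ⟩
        prefix L w″ ℓ ▸ w″ ℓ
          ≡⟨ hom-last L w″ ℓ ℓ-last ⟨
        hom (wordList w″) ∎
        where open ≡-Reasoning
      suffixValue-correct (just s) ℓ ℓ-last = begin
        (inv (prefixTwiceSet (centreAt x) (pointAt x s) ▸ w″ s) · prefixTwiceSet (centreAt x) (pointAt x ℓ)) ▸ w″ ℓ
          ≡⟨ cong₂ (λ ps pℓ → (inv (ps ▸ w″ s) · pℓ) ▸ w″ ℓ) (prefixTwiceSet-correct s) (prefixTwiceSet-correct ℓ) ⟩
        (inv (prefix L w″ s ▸ w″ s) · prefix L w″ ℓ) ▸ w″ ℓ
          ≡⟨ ·-▸-assoc _ _ (w″ ℓ) ⟩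
        inv (prefix L w″ s ▸ w″ s) · (prefix L w″ ℓ ▸ w″ ℓ)
          ≡⟨ cong (inv (prefix L w″ s ▸ w″ s) ·_) (hom-last L w″ ℓ ℓ-last) ⟨
        inv (prefix L w″ s ▸ w″ s) · hom (wordList w″)
          ≡⟨ hom-suffix L w″ s ⟨
        hom (sub (s <ᵇ_) w″) ∎
        where open ≡-Reasoning

    monoFormula-eval : ∀ {v} (ρ : Fin v → Fin n) c (xv iv : Fin v) → ρ iv ≡ i → ∀ (lo : Maybe (Fin v)) L r
      (g : El Stored → El (prefixCode L r)) → (∀ y → g (stored w y) ≡ prefixes L r w y) →
      evalEx S′ ρ (monoFormula σ c xv iv lo L r g) ≡ monoAccepts L r (mapMaybe ρ lo) (setWord (c , ρ xv) w′)
    monoFormula-eval ρ c xv iv ρiv≡i lo L [] g g-prefixes =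
      trans (anyFin-cong λ d → trans (decide-eval (ext d ρ) (suc xv) (suc iv) ρiv≡i zero (mapMaybe suc lo) endBool)
                                     (cong (λ lo′ → isLast d ∧ F (suffixValue (centreAt (ρ xv)) (pointAt (ρ xv) d) (boundAt (ρ xv) lo′ d)))
                                           (mapMaybe-ext-suc ρ d lo)))
            (anyFin-guarded isLast _ _ (proj₁ (last-exists (ρ xv))) (proj₂ (last-exists (ρ xv)))
              λ ℓ ℓ-last → cong F (suffixValue-correct (mapMaybe ρ lo) ℓ (isLast-sound ℓ ℓ-last)))
      where
      open MonomialAt L g g-prefixes c (ρ xv)
      open GroupValues L using (F)
      open Evaluation L g σ c using (suffixValue; endBool)
    monoFormula-eval ρ c xv iv ρiv≡i lo L ((a , L′) ∷ r) g g-prefixes =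
      anyFin-cong λ d →
        trans (conjEx-eval S′ (ext d ρ) _ (monoFormula σ c (suc xv) (suc iv) (just zero) L′ r (proj₂ ∘ g)))
              (cong₂ _∧_
                (trans (decide-eval (ext d ρ) (suc xv) (suc iv) ρiv≡i zero (mapMaybe suc lo) (stepBool a))
                       (trans (cong (λ lo′ → stepBool a (centreAt (ρ xv)) (pointAt (ρ xv) d) (boundAt (ρ xv) lo′ d)) (mapMaybe-ext-suc ρ d lo))
                              (stepBool-correct a (mapMaybe ρ lo) d)))
                (monoFormula-eval (ext d ρ) c (suc xv) (suc iv) ρiv≡i (just zero) L′ r (proj₂ ∘ g) (cong proj₂ ∘ g-prefixes)))
      where
      open MonomialAt L (proj₁ ∘ g) (cong proj₁ ∘ g-prefixes) c (ρ xv)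
      open Evaluation L (proj₁ ∘ g) σ c using (stepBool)

    localAfterSet-correct : ∀ x → localAfterSet σ (centreAt x) ≡ local w′ x
    localAfterSet-correct x = cong (λ p → isLast x , w′ x , p) (sym (prefixesB-setWord B w σ i x))

    module _ (x : Fin n) where

      localFormulas-eval : map (evalEx S′ (env2 x i)) (tabulate (localFormula σ)) ≡ encode Local (local w′ x)
      localFormulas-eval = begin
        map (evalEx S′ (env2 x i)) (tabulate (localFormula σ))
          ≡⟨ tabulate-∘ (evalEx S′ (env2 x i)) (localFormula σ) ⟨
        tabulate (evalEx S′ (env2 x i) ∘ localFormula σ)
          ≡⟨ tabulate-cong bit ⟩
        tabulate (lookup (encode Local (local w′ x)))
          ≡⟨ tabulate∘lookup _ ⟩
        encode Local (local w′ x) ∎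
        where
        open ≡-Reasoning
        bit : ∀ j → evalEx S′ (env2 x i) (localFormula σ j) ≡ lookup (encode Local (local w′ x)) j
        bit j =
          trans (read (readCentre-reads (env2 x i) zero (suc zero) refl) λ cd → constQF (lookup (encode Local (localAfterSet σ cd)) j))
                (trans (constQF-eval S′ (env2 x i) _) (cong (λ l → lookup (encode Local l) j) (localAfterSet-correct x)))

      tableFormulas-eval : ∀ B′ (g : El Stored → El (prefixCodeB B′)) → (∀ y → g (stored w y) ≡ prefixesB B′ w y) →
        map (evalEx S′ (env2 x i)) (tableFormulas σ B′ g) ≡ encode (tableCode B′) (tables B′ w′ x)
      tableFormulas-eval (atom (mono L r)) g g-prefixes =
        trans (sym (tabulate-∘ (evalEx S′ (env2 x i)) λ c → monoFormula σ (fromIndex c) zero (suc zero) nothing L r g))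
              (tabulate-cong λ c → monoFormula-eval (env2 x i) (fromIndex c) zero (suc zero) refl nothing L r g g-prefixes)
      tableFormulas-eval (neg B′) g g-prefixes = tableFormulas-eval B′ g g-prefixes
      tableFormulas-eval (conj B′ C) g g-prefixes =
        trans (map-++ (evalEx S′ (env2 x i)) (tableFormulas σ B′ (proj₁ ∘ g)) (tableFormulas σ C (proj₂ ∘ g)))
              (cong₂ _++ᵛ_ (tableFormulas-eval B′ (proj₁ ∘ g) (cong proj₁ ∘ g-prefixes)) (tableFormulas-eval C (proj₂ ∘ g) (cong proj₂ ∘ g-prefixes)))
      tableFormulas-eval (disj B′ C) g g-prefixes =
        trans (map-++ (evalEx S′ (env2 x i)) (tableFormulas σ B′ (proj₁ ∘ g)) (tableFormulas σ C (proj₂ ∘ g)))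
              (cong₂ _++ᵛ_ (tableFormulas-eval B′ (proj₁ ∘ g) (cong proj₁ ∘ g-prefixes)) (tableFormulas-eval C (proj₂ ∘ g) (cong proj₂ ∘ g-prefixes)))

      updateFormula-eval : ∀ j →
        evalEx S′ (env2 x i) (lookup (updateFormulas σ) j) ≡ lookup (encode Stored (stored w′ x)) j
      updateFormula-eval j =
        trans (sym (lookup-map j (evalEx S′ (env2 x i)) (updateFormulas σ)))
              (cong (λ bits → lookup bits j)
                    (trans (map-++ (evalEx S′ (env2 x i)) (tabulate (localFormula σ)) (tableFormulas σ B storedPrefixes))
                           (cong₂ _++ᵛ_ localFormulas-eval (tableFormulas-eval B storedPrefixes (λ _ → refl)))))

    acceptFormula-eval : evalEx S′ (env1 i) (acceptFormula σ) ≡ accepts B w′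
    acceptFormula-eval = trans (read (readStored-reads (env1 i) zero) λ D → constQF (acceptsByTables B (storedTables D) σ))
                               (trans (constQF-eval S′ (env1 i) _) (acceptsByTables-correct B w i σ))

  storedBlank : Bool → El Stored
  storedBlank l = (l , nothing , unitPrefixesB B) , letterTables B

  stored-blank : ∀ {n} (y : Fin n) → stored blank y ≡ storedBlank (isLast y)
  stored-blank y = cong₂ (λ p t → (isLast y , nothing , p) , t) (prefixesB-blank B y) (tables-blank B y)

  storedBlankBit : Bool → Fin A1 → FO k 0 0 1
  storedBlankBit l j = constFO (lookup (encode Stored (storedBlank l)) j)

  -- In the context (x); the condition reads ∀ z. z ≤ x.
  initFormula : Fin A1 → FO k 0 0 1
  initFormula j = ifFO (all (atom (leq zero (suc zero)))) (storedBlankBit true j) (storedBlankBit false j)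

  initFormula-eval : ∀ {n} (S : Str k 0 0 n) y j →
    evalFO S (env1 y) (initFormula j) ≡ lookup (encode Stored (storedBlank (isLast y))) j
  initFormula-eval S y j =
    trans (ifFO-eval S (env1 y) (all (atom (leq zero (suc zero)))) (storedBlankBit true j) (storedBlankBit false j))
          (byLast (isLast y))
    where
    byLast : ∀ l → (if l then evalFO S (env1 y) (storedBlankBit true j) else evalFO S (env1 y) (storedBlankBit false j))
                   ≡ lookup (encode Stored (storedBlank l)) j
    byLast true  = constFO-eval S (env1 y) _
    byLast false = constFO-eval S (env1 y) _

  program : UDynProg k 1 A1
  program = record
    { acc   = zero
    ; init0 = λ _ → constFO (accepts B (blank {n = 0}))
    ; init1 = initFormula
    ; upd0  = λ σ _ → acceptFormula σ
    ; upd1  = λ σ j → lookup (updateFormulas σ) j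
    }

  Invariant : ∀ {n} → Str k 1 A1 n → Set
  Invariant S = (∀ j y → r1 S j y ≡ lookup (encode Stored (stored (word S) y)) j) × (r0 S zero ≡ accepts B (word S))

  invariant-init : ∀ n → Invariant (initStr program n)
  invariant-init n =
    (λ j y → trans (initFormula-eval _ y j) (cong (λ D → lookup (encode Stored D) j) (sym (stored-blank y)))) ,
                     trans (constFO-eval _ _ _) (accepts-wordList B blank blank (sym (wordList-blank {k} {n})))

  invariant-step : ∀ {n} (S : Str k 1 A1 n) ch → Invariant S → Invariant (step program S ch)
  invariant-step S (σ , i) (R1-stored , _) = (λ j x → updateFormula-eval x j) , acceptFormula-eval
    where open Update (word S) σ i (r0 S) (r1 S) R1-stored

  invariant-run : ∀ n cs → Invariant (run program n cs)
  invariant-run n = go (initStr program n) (invariant-init n)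
    where
    go : ∀ S → Invariant S → ∀ cs → Invariant (foldl (step program) S cs)
    go S inv []       = inv
    go S inv (c ∷ cs) = go (step program S c) (invariant-step S c inv) cs

  program-maintains : Maintains program ⟦ B ⟧B
  program-maintains n cs =
    subst (λ b → (b ≡ true) ⇔ ⟦ B ⟧B (wordList (word (run program n cs)))) (sym (proj₂ (invariant-run n cs)))
          (accepts-correct B (word (run program n cs)))

Maintains-⇔ : ∀ {k a0 a1} (P : UDynProg k a0 a1) {L L′ : Language k} →
  (∀ w → L w ⇔ L′ w) → Maintains P L′ → Maintains P L
Maintains-⇔ P L⇔L′ maintains n cs = mk⇔ (λ acc → from (L⇔L′ _) (to (maintains n cs) acc))
                                       (λ w∈L → from (maintains n cs) (to (L⇔L′ _) w∈L))

mainTheorem18 : ∀ {k : ℕ} (L : Language k) → InJG L → MemberInUDynΣ₁ L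
mainTheorem18 L (B , L⇔B) = 1 , A1 , program , Maintains-⇔ program L⇔B program-maintains
  where open Program B
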